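{- Let $G=(V,\mathcal D,\ell_v)$ and $G'=(V',\mathcal D',\ell'_v)$ be finite node-labeled digraphs that are weakly connected, simple, oriented and transitively closed. Let $(U,\phi)$ be a feasible solution such that there exist $u,v\in U$ with $\ell_v(u)=\ell_v(v)$, $(u,v)\in\mathcal D$ and $(\phi(v),\phi(u))\in\mathcal D'$, and let $\psi:U\to V'$ be defined by $\psi(u)=\phi(v)$, $\psi(v)=\phi(u)$ and $\psi(x)=\phi(x)$ for all $x\in U\setminus\{u,v\}$ (a minimally untwisted map of $\phi$). Then $\mathcal P(U,\phi)<\mathcal P(U,\psi)$.
   Context: A node-labeled digraph $G=(V,\mathcal D,\ell_v)$ consists of a finite node set $V$, directed edges $\mathcal D\subseteq V\times V$, and a node-labeling function $\ell_v$ on $V$. Weakly connected: underlying undirected graph connected. Simple: no self-loops and no parallel edges with the same source and target. Oriented: no pair $(a,b),(b,a)$ both in $\mathcal D$. Transitively closed: whenever $(a,b),(b,c)\in\mathcal D$ with $a\neq c$, also $(a,c)\in\mathcal D$. A feasible solution is a pair $(U,\phi)$ with $U\subseteq V$ and $\phi:U\to V'$ injective with $\ell'_v(\phi(x))=\ell_v(x)$ for all $x\in U$; its score is $\mathcal P(U,\phi)=|\{(v_1,v_2)\in U\times U:(v_1,v_2)\in\mathcal D,\ (\phi(v_1),\phi(v_2))\in\mathcal D'\}|$. -}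

module Defs where

open import Data.Nat using (ℕ; zero; suc; _+_)
open import Data.Bool using (Bool; true; false; _∧_; T; if_then_else_)
open import Data.Fin using (Fin; _≟_)
open import Data.Vec using (lookup)
open import Data.Fin.Subset using (Subset; _∈_)
open import Data.List using (List; []; _∷_; map; allFin)
open import Data.Nat.ListAction using (sum)
open import Data.Product using (_×_; ∃; _,_)
open import Data.Sum using (_⊎_)
open import Relation.Binary.PropositionalEquality using (_≡_; _≢_)
open import Relation.Nullary using (¬_; does)

record Digraph (L : Set) : Set where
  field
    n     : ℕ
    edge  : Fin n → Fin n → Bool
    label : Fin n → L

open Digraph public

Edge : ∀ {L} (G : Digraph L) → Fin (n G) → Fin (n G) → Set
Edge G a b = T (edge G a b)

data Walk {L} (G : Digraph L) : Fin (n G) → Fin (n G) → Set where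
  here : ∀ {a} → Walk G a a
  fwd  : ∀ {a b c} → Edge G a b → Walk G b c → Walk G a c
  bwd  : ∀ {a b c} → Edge G b a → Walk G b c → Walk G a c

WeaklyConnected : ∀ {L} → Digraph L → Set
WeaklyConnected G = ∀ a b → Walk G a b

-- no self-loops (parallel edges are impossible with an edge relation)
Simple : ∀ {L} → Digraph L → Set
Simple G = ∀ a → ¬ Edge G a a

Oriented : ∀ {L} → Digraph L → Set
Oriented G = ∀ a b → Edge G a b → ¬ Edge G b a

TransitivelyClosed : ∀ {L} → Digraph L → Set
TransitivelyClosed G = ∀ a b c → Edge G a b → Edge G b c → a ≢ c → Edge G a c

record Admissible {L} (G : Digraph L) : Set where
  field
    weaklyConnected    : WeaklyConnected G
    simple             : Simple G
    oriented           : Oriented G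
    transitivelyClosed : TransitivelyClosed G

-- Feasible solution (U, φ): U a subset of V, φ : V → V' whose values outside U
-- are irrelevant; φ injective on U and label-preserving on U.
Feasible : ∀ {L} (G G' : Digraph L) → Subset (n G) → (Fin (n G) → Fin (n G')) → Set
Feasible G G' U φ =
  (∀ x y → x ∈ U → y ∈ U → φ x ≡ φ y → x ≡ y) ×
  (∀ x → x ∈ U → label G' (φ x) ≡ label G x)

inU : ∀ {m} → Subset m → Fin m → Bool
inU U a = lookup U a

score : ∀ {L} (G G' : Digraph L) → Subset (n G) → (Fin (n G) → Fin (n G')) → ℕ
score G G' U φ =
  sum (map (λ a → sum (map (λ b →
         if inU U a ∧ inU U b ∧ edge G a b ∧ edge G' (φ a) (φ b) then 1 else 0)
       (allFin (n G)))) (allFin (n G)))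

untwist : ∀ {m m'} → (Fin m → Fin m') → Fin m → Fin m → Fin m → Fin m'
untwist φ u v x =
  if does (x ≟ u) then φ v else (if does (x ≟ v) then φ u else φ x)

-- Write P(U, χ) as a double sum over ordered pairs (a, b) of the indicator that (a, b) is an
-- arc of G with a, b ∈ U whose image under χ is an arc of G'.  Untwisting only changes the
-- terms of pairs meeting {u, v}.  For a ∉ {u, v} the terms of (a, u) and (a, v), and those of
-- (u, a) and (v, a), are exchanged without loss: transitivity along u → v in G and along
-- φ v → φ u in G' (with injectivity of φ) turns each arc preserved by φ into one preserved
-- by ψ.  On {u, v}² the map φ preserves no arc (simplicity and orientation), whereas ψ
-- preserves u → v.
module Submission where

open import Defs
open import Data.Nat using (_<_)
open import Data.Fin.Subset using (Subset; _∈_)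
open import Data.Fin using (Fin)
open import Relation.Binary.PropositionalEquality using (_≡_)

open import Data.Bool using (Bool; true; false; _∧_; T; if_then_else_)
open import Data.Bool.Properties using (T-≡)
open import Data.Empty using (⊥-elim)
open import Data.Fin using (zero; suc; _≟_; punchIn)
open import Data.Fin.Properties using (punchInᵢ≢i)
open import Data.List using (map; allFin; tabulate)
open import Data.List.Properties using (map-tabulate)
open import Data.Nat using (ℕ; zero; suc; _+_; _≤_; z≤n; s≤s)
open import Data.Nat.ListAction using () renaming (sum to sumᴸ)
open import Data.Nat.Properties
  using ( +-assoc; +-comm; +-mono-≤; +-mono-<-≤; +-mono-≤-<; ≤-reflexive; ≤-refl; m≤n+m
        ; +-0-commutativeMonoid; module ≤-Reasoning)
open import Data.Product using (_,_)
open import Data.Vec.Functional using (Vector; updateAt; removeAt)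
open import Data.Vec.Functional.Properties using (updateAt-updates; updateAt-minimal)
open import Data.Vec.Properties using ([]=⇒lookup; lookup⇒[]=)
open import Function using (_∘_; const; Equivalence)
open import Relation.Binary.PropositionalEquality
  using (_≢_; refl; sym; trans; cong; cong₂; subst; subst₂; module ≡-Reasoning)
open import Relation.Nullary using (¬_; yes; no)
open import Relation.Nullary.Decidable using (dec-true; dec-false)

open import Algebra.Properties.CommutativeMonoid.Sum +-0-commutativeMonoid
  using (sum; sum-syntax; sum-remove; sum-cong-≗; ∑-distrib-+)

sum-map-allFin : ∀ {m} (h : Fin m → ℕ) → sumᴸ (map h (allFin m)) ≡ sum h
sum-map-allFin h = trans (cong sumᴸ (map-tabulate (λ i → i) h)) (sum-tabulate h)
  where
  sum-tabulate : ∀ {m} (f : Fin m → ℕ) → sumᴸ (tabulate f) ≡ sum f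
  sum-tabulate {zero}  f = refl
  sum-tabulate {suc m} f = cong (f zero +_) (sum-tabulate (f ∘ suc))

∑-mono-≤ : ∀ {m} {f g : Vector ℕ m} → (∀ i → f i ≤ g i) → sum f ≤ sum g
∑-mono-≤ {zero}  f≤g = z≤n
∑-mono-≤ {suc m} f≤g = +-mono-≤ (f≤g zero) (∑-mono-≤ (f≤g ∘ suc))

vanishAt : ∀ {m} → Fin m → Vector ℕ m → Vector ℕ m
vanishAt i h = updateAt h i (const 0)

vanishAt-mono : ∀ {m} {f g : Vector ℕ m} (i j : Fin m) →
  (j ≢ i → f j ≤ g j) → vanishAt i f j ≤ vanishAt i g j
vanishAt-mono {f = f} {g} i j f≤g with j ≟ i
... | yes refl = subst₂ _≤_ (sym (updateAt-updates i f)) (sym (updateAt-updates i g)) z≤n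
... | no j≢i   = subst₂ _≤_ (sym (updateAt-minimal j i f j≢i)) (sym (updateAt-minimal j i g j≢i))
                   (f≤g j≢i)

∑-split-at : ∀ {m} (i : Fin m) (h : Vector ℕ m) → sum h ≡ h i + sum (vanishAt i h)
∑-split-at {suc m} i h = begin
  sum h                                 ≡⟨ sum-remove h ⟩
  h i + sum (removeAt h i)              ≡⟨ cong (h i +_) (sum-cong-≗ unchanged) ⟩
  h i + sum (removeAt h₀ i)
    ≡⟨ cong (λ x → h i + (x + sum (removeAt h₀ i))) (updateAt-updates i h) ⟨
  h i + (h₀ i + sum (removeAt h₀ i))    ≡⟨ cong (h i +_) (sum-remove h₀) ⟨
  h i + sum h₀                          ∎
  where
  open ≡-Reasoning
  h₀ : Vector ℕ (suc m)
  h₀ = vanishAt i h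
  unchanged : ∀ j → h (punchIn i j) ≡ h₀ (punchIn i j)
  unchanged j = sym (updateAt-minimal (punchIn i j) i h (punchInᵢ≢i i j))

∑-split-pair : ∀ {m} {u v : Fin m} (h : Vector ℕ m) → u ≢ v →
  sum h ≡ h u + h v + sum (vanishAt v (vanishAt u h))
∑-split-pair {m} {u} {v} h u≢v = begin
  sum h                                ≡⟨ ∑-split-at u h ⟩
  h u + sum (vanishAt u h)             ≡⟨ cong (h u +_) (∑-split-at v (vanishAt u h)) ⟩
  h u + (vanishAt u h v + sum rest)
    ≡⟨ cong (λ x → h u + (x + sum rest)) (updateAt-minimal v u h (u≢v ∘ sym)) ⟩
  h u + (h v + sum rest)               ≡⟨ +-assoc (h u) (h v) (sum rest) ⟨
  h u + h v + sum rest                 ∎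
  where
  open ≡-Reasoning
  rest : Vector ℕ m
  rest = vanishAt v (vanishAt u h)

module _ {m} {f g : Vector ℕ m} {u v : Fin m} (u≢v : u ≢ v)
         (off-pair : ∀ i → i ≢ u → i ≢ v → f i ≤ g i) where

  private
    rest-mono : ∀ i → vanishAt v (vanishAt u f) i ≤ vanishAt v (vanishAt u g) i
    rest-mono i = vanishAt-mono v i (λ i≢v → vanishAt-mono u i (λ i≢u → off-pair i i≢u i≢v))

  ∑-exchange-≤ : f u + f v ≤ g u + g v → sum f ≤ sum g
  ∑-exchange-≤ pair = subst₂ _≤_ (sym (∑-split-pair f u≢v)) (sym (∑-split-pair g u≢v))
    (+-mono-≤ pair (∑-mono-≤ rest-mono))

  ∑-exchange-< : f u + f v < g u + g v → sum f < sum g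
  ∑-exchange-< pair = subst₂ _<_ (sym (∑-split-pair f u≢v)) (sym (∑-split-pair g u≢v))
    (+-mono-<-≤ pair (∑-mono-≤ rest-mono))

indicator : Bool → ℕ
indicator b = if b then 1 else 0

indicator-mono : ∀ {p q} → (T p → T q) → indicator p ≤ indicator q
indicator-mono {false}         _   = z≤n
indicator-mono {true}  {true}  _   = ≤-refl
indicator-mono {true}  {false} p⇒q = ⊥-elim (p⇒q _)

indicator-exchange : ∀ g p q r s → (T g → T p → T q) → (T g → T s → T r) →
  indicator (g ∧ p ∧ r) + indicator (g ∧ q ∧ s) ≤ indicator (g ∧ p ∧ s) + indicator (g ∧ q ∧ r)
indicator-exchange false _     _     _ _ _   _   = z≤n
indicator-exchange true  true  false _ _ p⇒q _   = ⊥-elim (p⇒q _ _)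
indicator-exchange true  true  true  r s _   _   = ≤-reflexive (+-comm (indicator r) (indicator s))
indicator-exchange true  false false _ _ _   _   = z≤n
indicator-exchange true  false true  _ _ _   s⇒r = indicator-mono (s⇒r _)

untwist-fst : ∀ {m m'} (φ : Fin m → Fin m') (u v : Fin m) → untwist φ u v u ≡ φ v
untwist-fst φ u v rewrite dec-true (u ≟ u) refl = refl

untwist-snd : ∀ {m m'} (φ : Fin m → Fin m') {u v : Fin m} → u ≢ v → untwist φ u v v ≡ φ u
untwist-snd φ {u} {v} u≢v
  rewrite dec-false (v ≟ u) (u≢v ∘ sym) | dec-true (v ≟ v) refl = refl

untwist-other : ∀ {m m'} (φ : Fin m → Fin m') {u v x : Fin m} → x ≢ u → x ≢ v →
  untwist φ u v x ≡ φ x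
untwist-other φ {u} {v} {x} x≢u x≢v
  rewrite dec-false (x ≟ u) x≢u | dec-false (x ≟ v) x≢v = refl

module _ {L : Set} (G G' : Digraph L) (U : Subset (n G)) where

  pairScore : (Fin (n G) → Fin (n G')) → Fin (n G) → Fin (n G) → ℕ
  pairScore χ a b = indicator (inU U a ∧ inU U b ∧ edge G a b ∧ edge G' (χ a) (χ b))

  score≡∑∑pairScore : ∀ χ → score G G' U χ ≡ ∑[ a < n G ] ∑[ b < n G ] pairScore χ a b
  score≡∑∑pairScore χ = begin
    sumᴸ (map (λ a → sumᴸ (map (pairScore χ a) (allFin (n G)))) (allFin (n G)))
      ≡⟨ sum-map-allFin (λ a → sumᴸ (map (pairScore χ a) (allFin (n G)))) ⟩
    ∑[ a < n G ] sumᴸ (map (pairScore χ a) (allFin (n G)))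
      ≡⟨ sum-cong-≗ (λ a → sum-map-allFin (pairScore χ a)) ⟩
    ∑[ a < n G ] ∑[ b < n G ] pairScore χ a b ∎
    where open ≡-Reasoning

  pairScore-cong : ∀ {χ χ'} a b → χ a ≡ χ' a → χ b ≡ χ' b → pairScore χ a b ≡ pairScore χ' a b
  pairScore-cong a b = cong₂ (λ x y → indicator (inU U a ∧ inU U b ∧ edge G a b ∧ edge G' x y))

  pairScore≡0 : ∀ χ {a b} → (Edge G a b → ¬ Edge G' (χ a) (χ b)) → pairScore χ a b ≡ 0
  pairScore≡0 χ {a} {b} no-arc with inU U a | inU U b | edge G a b | edge G' (χ a) (χ b)
  ... | false | _     | _     | _     = refl
  ... | true  | false | _     | _     = refl
  ... | true  | true  | false | _     = refl
  ... | true  | true  | true  | false = refl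
  ... | true  | true  | true  | true  = ⊥-elim (no-arc _ _)

  pairScore≡1 : ∀ χ {a b} → a ∈ U → b ∈ U → Edge G a b → Edge G' (χ a) (χ b) → pairScore χ a b ≡ 1
  pairScore≡1 χ a∈U b∈U ab χaχb
    rewrite []=⇒lookup a∈U | []=⇒lookup b∈U
          | Equivalence.to T-≡ ab | Equivalence.to T-≡ χaχb = refl

edge⇒≢ : ∀ {L} (G : Digraph L) → Simple G → ∀ {a b} → Edge G a b → a ≢ b
edge⇒≢ G simple {a} a→b refl = simple a a→b

T-inU⇒∈ : ∀ {m} {U : Subset m} {a : Fin m} → T (inU U a) → a ∈ U
T-inU⇒∈ {U = U} {a} t = lookup⇒[]= a U (Equivalence.to T-≡ t)

module Untwisting {L : Set} {G G' : Digraph L} (AG : Admissible G) (AG' : Admissible G')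
         {U : Subset (n G)} {φ : Fin (n G) → Fin (n G')}
         (φ-inj : ∀ x y → x ∈ U → y ∈ U → φ x ≡ φ y → x ≡ y)
         {u v : Fin (n G)} (u∈U : u ∈ U) (v∈U : v ∈ U)
         (u→v : Edge G u v) (φv→φu : Edge G' (φ v) (φ u)) where

  open Admissible

  ψ : Fin (n G) → Fin (n G')
  ψ = untwist φ u v

  u≢v : u ≢ v
  u≢v = edge⇒≢ G (simple AG) u→v

  private
    P : (Fin (n G) → Fin (n G')) → Fin (n G) → Fin (n G) → ℕ
    P = pairScore G G' U

    φ-distinct : ∀ {a x} → T (inU U a) → x ∈ U → a ≢ x → φ a ≢ φ x
    φ-distinct {a} {x} a∈U x∈U a≢x = a≢x ∘ φ-inj a x (T-inU⇒∈ a∈U) x∈U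

    row-pair-exchange : ∀ {a} → a ≢ u → a ≢ v → P φ a u + P φ a v ≤ P ψ a u + P ψ a v
    row-pair-exchange {a} a≢u a≢v
      rewrite untwist-other φ a≢u a≢v | untwist-fst φ u v | untwist-snd φ u≢v
            | []=⇒lookup u∈U | []=⇒lookup v∈U
      = indicator-exchange (inU U a) (edge G a u) (edge G a v)
          (edge G' (φ a) (φ u)) (edge G' (φ a) (φ v))
          (λ _ a→u → transitivelyClosed AG a u v a→u u→v a≢v)
          (λ a∈U φa→φv → transitivelyClosed AG' (φ a) (φ v) (φ u) φa→φv φv→φu
                           (φ-distinct a∈U u∈U a≢u))

    column-pair-exchange : ∀ {b} → b ≢ u → b ≢ v → P φ v b + P φ u b ≤ P ψ v b + P ψ u b
    column-pair-exchange {b} b≢u b≢v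
      rewrite untwist-other φ b≢u b≢v | untwist-fst φ u v | untwist-snd φ u≢v
            | []=⇒lookup u∈U | []=⇒lookup v∈U
      = indicator-exchange (inU U b) (edge G v b) (edge G u b)
          (edge G' (φ v) (φ b)) (edge G' (φ u) (φ b))
          (λ _ v→b → transitivelyClosed AG u v b u→v v→b (b≢u ∘ sym))
          (λ b∈U φu→φb → transitivelyClosed AG' (φ v) (φ u) (φ b) φv→φu φu→φb
                           (φ-distinct b∈U v∈U b≢v ∘ sym))

    column-u : P φ v u + P φ u u ≤ P ψ v u + P ψ u u
    column-u = subst (_≤ P ψ v u + P ψ u u) (sym no-arcs) z≤n
      where
      no-arcs : P φ v u + P φ u u ≡ 0
      no-arcs = cong₂ _+_ (pairScore≡0 G G' U φ (λ v→u _ → oriented AG u v u→v v→u))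
                          (pairScore≡0 G G' U φ (λ u→u _ → simple AG u u→u))

    column-v : P φ v v + P φ u v < P ψ v v + P ψ u v
    column-v = begin-strict
      P φ v v + P φ u v  ≡⟨ no-arcs ⟩
      0                  <⟨ s≤s z≤n ⟩
      1                  ≡⟨ untwisted-arc ⟨
      P ψ u v            ≤⟨ m≤n+m (P ψ u v) (P ψ v v) ⟩
      P ψ v v + P ψ u v  ∎
      where
      open ≤-Reasoning
      no-arcs : P φ v v + P φ u v ≡ 0
      no-arcs = cong₂ _+_ (pairScore≡0 G G' U φ (λ v→v _ → simple AG v v→v))
                          (pairScore≡0 G G' U φ (λ _ φu→φv → oriented AG' (φ v) (φ u) φv→φu φu→φv))
      untwisted-arc : P ψ u v ≡ 1
      untwisted-arc = pairScore≡1 G G' U ψ u∈U v∈U u→v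
        (subst₂ (Edge G') (sym (untwist-fst φ u v)) (sym (untwist-snd φ u≢v)) φv→φu)

  untwist-row-≤ : ∀ a → a ≢ v → a ≢ u → ∑[ b < n G ] P φ a b ≤ ∑[ b < n G ] P ψ a b
  untwist-row-≤ a a≢v a≢u = ∑-exchange-≤ u≢v same-off-pair (row-pair-exchange a≢u a≢v)
    where
    same-off-pair : ∀ b → b ≢ u → b ≢ v → P φ a b ≤ P ψ a b
    same-off-pair b b≢u b≢v = ≤-reflexive (pairScore-cong G G' U a b
      (sym (untwist-other φ a≢u a≢v)) (sym (untwist-other φ b≢u b≢v)))

  untwist-rows-< : ∑[ b < n G ] P φ v b + ∑[ b < n G ] P φ u b
                 < ∑[ b < n G ] P ψ v b + ∑[ b < n G ] P ψ u b
  untwist-rows-< = subst₂ _<_ (∑-distrib-+ (P φ v) (P φ u)) (∑-distrib-+ (P ψ v) (P ψ u))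
    (∑-exchange-< u≢v (λ b b≢u b≢v → column-pair-exchange b≢u b≢v)
                      (+-mono-≤-< column-u column-v))

lemma8p3 : {L : Set} (G G' : Digraph L) → Admissible G → Admissible G' →
    (U : Subset (n G)) (φ : Fin (n G) → Fin (n G')) → Feasible G G' U φ →
    (u v : Fin (n G)) → u ∈ U → v ∈ U → label G u ≡ label G v →
    Edge G u v → Edge G' (φ v) (φ u) →
    score G G' U φ < score G G' U (untwist φ u v)
lemma8p3 G G' AG AG' U φ (φ-inj , _) u v u∈U v∈U _ u→v φv→φu = begin-strict
  score G G' U φ                                    ≡⟨ score≡∑∑pairScore G G' U φ ⟩
  ∑[ a < n G ] ∑[ b < n G ] pairScore G G' U φ a b
    <⟨ ∑-exchange-< (u≢v ∘ sym) untwist-row-≤ untwist-rows-< ⟩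
  ∑[ a < n G ] ∑[ b < n G ] pairScore G G' U ψ a b  ≡⟨ score≡∑∑pairScore G G' U ψ ⟨
  score G G' U ψ                                    ∎
  where
  open ≤-Reasoning
  open Untwisting AG AG' φ-inj u∈U v∈U u→v φv→φu
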